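{- Let $\varphi(\mathbf{x},\mathbf{y})$ be a P-encoding with $n\ge3$ input variables $\mathbf{x}=(x_1,\dots,x_n)$ such that $|Q_{\varphi,i}|\ne 2$ for some $i\in\{1,\dots,n\}$. Then there is a formula $\varphi'$ satisfying one of the following: (a) $\varphi'$ is a P-encoding with $n$ input variables and $|\varphi|\ge|\varphi'|+1$; (b) $\varphi'$ is a P-encoding with $n-1$ input variables and $|\varphi|\ge|\varphi'|+3$. Moreover, if $\varphi$ is a 2-CNF formula, then so is $\varphi'$.
   Context: A CNF formula is a conjunction (set) of clauses (disjunctions of literals with no complementary pair); its size $|\varphi|$ is its number of clauses; a 2-CNF formula has all clauses of at most two literals. Unit resolution: from a unit clause $l$ and a clause containing $\neg l$ derive the clause with $\neg l$ removed; $\varphi\wedge g\vdash_1 h$ means the literal $h$ is derivable from $\varphi$ and the unit clause $g$ by a sequence of unit resolutions. A CNF formula $\varphi(\mathbf{x},\mathbf{y})$ with input variables $x_1,\dots,x_n$ and auxiliary variables $\mathbf{y}$ is a P-encoding if (P1) $\varphi\wedge x_i$ is satisfiable for each $i$ and (P2) $\varphi\wedge x_i\vdash_1\neg x_j$ for all $i\ne j$. $Q_{\varphi,i}=\{C\in\varphi:\neg x_i\in C\}$. -}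

module Defs where

open import Data.Nat using (ℕ; suc; _≤_; _∸_)
open import Data.Fin using (Fin)
import Data.Fin.Properties as FinP
open import Data.Sum using (_⊎_; inj₁; inj₂)
import Data.Sum.Properties as SumP
open import Data.Bool using (Bool; true; false; not)
open import Data.List using (List; []; _∷_; length; filter)
open import Data.List.Membership.DecPropositional using ()
import Data.List.Membership.Propositional as MemP
open import Data.List.Relation.Unary.All using (All)
open import Data.List.Relation.Unary.Any using (Any)
open import Data.List.Relation.Unary.AllPairs using (AllPairs)
open import Data.List.Relation.Unary.Unique.Propositional using (Unique)
open import Data.Product using (Σ; _×_; ∃)
open import Relation.Nullary using (¬_; yes; no; ¬?)
open import Relation.Binary.PropositionalEquality using (_≡_; _≢_; refl; cong)
open import Relation.Binary.Definitions using (DecidableEquality)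

-- Variables of a formula with n input variables x_1..x_n (inj₁) and
-- m auxiliary variables y_1..y_m (inj₂).
Var : ℕ → ℕ → Set
Var n m = Fin n ⊎ Fin m

_≟V_ : ∀ {n m} → DecidableEquality (Var n m)
_≟V_ = SumP.≡-dec FinP._≟_ FinP._≟_

data Lit (n m : ℕ) : Set where
  pos : Var n m → Lit n m
  neg : Var n m → Lit n m

_≟L_ : ∀ {n m} → DecidableEquality (Lit n m)
pos u ≟L pos v with u ≟V v
... | yes refl = yes refl
... | no p = no λ { refl → p refl }
pos u ≟L neg v = no λ ()
neg u ≟L pos v = no λ ()
neg u ≟L neg v with u ≟V v
... | yes refl = yes refl
... | no p = no λ { refl → p refl }

compl : ∀ {n m} → Lit n m → Lit n m
compl (pos v) = neg v
compl (neg v) = pos v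

open module MemL {n m : ℕ} = Data.List.Membership.DecPropositional (_≟L_ {n} {m})
  using (_∈_; _∉_; _∈?_)

Clause : ℕ → ℕ → Set
Clause n m = List (Lit n m)

CNF : ℕ → ℕ → Set
CNF n m = List (Clause n m)

size : ∀ {n m} → CNF n m → ℕ
size = length

WFClause : ∀ {n m} → Clause n m → Set
WFClause C = Unique C × (∀ l → l ∈ C → compl l ∉ C)

_≈C_ : ∀ {n m} → Clause n m → Clause n m → Set
C ≈C D = ∀ l → (l ∈ C → l ∈ D) × (l ∈ D → l ∈ C)

-- Well-formed formula: well-formed clauses, pairwise distinct as sets
-- (so the list genuinely represents a set of clauses and size = number of clauses)
WF : ∀ {n m} → CNF n m → Set
WF φ = All WFClause φ × AllPairs (λ C D → ¬ (C ≈C D)) φ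

Is2CNF : ∀ {n m} → CNF n m → Set
Is2CNF φ = All (λ C → length C ≤ 2) φ

evalLit : ∀ {n m} → (Var n m → Bool) → Lit n m → Bool
evalLit a (pos v) = a v
evalLit a (neg v) = not (a v)

Satisfiable : ∀ {n m} → CNF n m → Set
Satisfiable {n} {m} φ =
  ∃ λ (a : Var n m → Bool) → All (λ C → Any (λ l → evalLit a l ≡ true) C) φ

removeLit : ∀ {n m} → Lit n m → Clause n m → Clause n m
removeLit k C = filter (λ x → ¬? (x ≟L k)) C

data UR {n m : ℕ} (ψ : CNF n m) : Clause n m → Set where
  axiom   : ∀ {C} → C MemP.∈ ψ → UR ψ C
  resolve : ∀ {l D} → UR ψ (l ∷ []) → UR ψ D → compl l ∈ D →
            UR ψ (removeLit (compl l) D)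

_∧_⊢₁_ : ∀ {n m} → CNF n m → Lit n m → Lit n m → Set
φ ∧ g ⊢₁ h = UR ((g ∷ []) ∷ φ) (h ∷ [])

x : ∀ {n m} → Fin n → Var n m
x = inj₁

IsPEncoding : ∀ {n m} → CNF n m → Set
IsPEncoding {n} φ =
  (∀ (i : Fin n) → Satisfiable ((pos (x i) ∷ []) ∷ φ)) ×
  (∀ (i j : Fin n) → i ≢ j → φ ∧ pos (x i) ⊢₁ neg (x j))

Q : ∀ {n m} → CNF n m → Fin n → CNF n m
Q φ i = filter (λ C → neg (x i) ∈? C) φ

module Submission where

-- Unit resolution is handled through the order-free notion `Forced` (trees
-- of unit propagation), equivalent to UR for duplicate-free clauses.  Both
-- reductions transport forcing trees and models to a rewritten formula,
-- which `normalise` (dropping tautologies, repeated literals and duplicate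
-- clauses) turns back into a well-formed P-encoding (`shrinks-by-normalising`).
--
-- Since xᵢ forces some ¬xⱼ that φ alone cannot force, propagation from xᵢ
-- uses a pivot clause E ∋ ¬xᵢ all of whose literals but ¬xᵢ and one ℓ are
-- refuted by φ (`pivot-exists`); in particular Q φ i is nonempty.
--   |Q φ i| = 1 (`UniquePivot`): E is the only clause with ¬xᵢ.  A third
--     input rules out that ℓ is an input literal, so ℓ = (lit b y) for an
--     auxiliary y; substituting y ↦ (lit b xᵢ) and dropping E gives a
--     P-encoding on n inputs with one clause fewer.
--   |Q φ i| ≥ 3 (`Eliminate`): every other input forces ¬xᵢ, so fixing xᵢ to
--     false (dropping Q, deleting xᵢ, renumbering) gives a P-encoding on
--     n - 1 inputs with at least three clauses fewer.
-- Neither rewriting lengthens a clause, which preserves 2-CNF.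

open import Defs
open import Data.Nat using (ℕ; suc; _≤_; _+_; _∸_; z≤n; s≤s)
import Data.Nat.Properties as ℕP
open import Data.Fin using (Fin; punchIn; punchOut) renaming (zero to fz; suc to fs)
import Data.Fin.Properties as FinP
open import Data.Sum using (_⊎_; inj₁; inj₂)
import Data.Sum.Properties as SumP
open import Data.Product using (Σ; _×_; ∃; _,_; proj₁; proj₂)
open import Data.Bool using (Bool; true; false; not)
open import Data.Bool.Properties using (not-involutive)
open import Data.List using (List; []; _∷_; map; filter; length; deduplicate)
import Data.List.Properties as ListP
open import Data.List.Membership.Propositional using (_∈_; find; lose)
import Data.List.Membership.Propositional.Properties as ∈P
open import Data.List.Relation.Unary.Any using (Any; here; there; any?)
import Data.List.Relation.Unary.Any.Properties as AnyP
open import Data.List.Relation.Unary.All as All using (All; []; _∷_; all?)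
import Data.List.Relation.Unary.All.Properties as AllP
open import Data.List.Relation.Unary.AllPairs using ([]; _∷_)
open import Data.List.Relation.Unary.Unique.Propositional using (Unique)
import Data.List.Relation.Unary.Unique.Propositional.Properties as UniqueP
import Data.List.Relation.Unary.Unique.DecPropositional.Properties as UniqueDecP
open import Data.Empty using (⊥; ⊥-elim)
open import Function using (_∘_)
open import Relation.Nullary using (¬_; yes; no; Dec; ¬?)
open import Relation.Nullary.Decidable using (_×-dec_)
open import Relation.Unary using (Decidable)
open import Relation.Binary.PropositionalEquality using (_≡_; _≢_; refl; sym; trans; cong; subst; subst₂)

private variable
  n m : ℕ

compl-involutive : (l : Lit n m) → compl (compl l) ≡ l
compl-involutive (pos v) = refl
compl-involutive (neg v) = refl

compl-injective : {l l' : Lit n m} → compl l ≡ compl l' → l ≡ l'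
compl-injective {l = l} {l'} e =
  trans (sym (compl-involutive l)) (trans (cong compl e) (compl-involutive l'))

compl-≢ : (l : Lit n m) → compl l ≢ l
compl-≢ (pos v) ()
compl-≢ (neg v) ()

assume : Lit n m → CNF n m → CNF n m
assume u φ = (u ∷ []) ∷ φ

Models : (Var n m → Bool) → CNF n m → Set
Models a ψ = All (λ C → Any (λ l → evalLit a l ≡ true) C) ψ

compl-not-both : (a : Var n m → Bool) (l : Lit n m) →
  evalLit a l ≡ true → evalLit a (compl l) ≡ true → ⊥
compl-not-both a (pos v) e1 e2 with a v
compl-not-both a (pos v) refl () | true
compl-not-both a (pos v) () e2 | false
compl-not-both a (neg v) e1 e2 with a v
compl-not-both a (neg v) () e2 | true
compl-not-both a (neg v) e1 () | false

-- Unlike UR, this notion is insensitive to literal order and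
-- to repeated literals, which makes it convenient to transport along maps.
data Forced {n m : ℕ} (ψ : CNF n m) : Lit n m → Set where
  by : ∀ {h} (C : Clause n m) → C ∈ ψ → h ∈ C →
       (∀ l → l ∈ C → l ≢ h → Forced ψ (compl l)) → Forced ψ h

forced-sound : ∀ {a : Var n m → Bool} {ψ h} → Models a ψ → Forced ψ h → evalLit a h ≡ true
forced-sound {a = a} {h = h} M (by C C∈ψ h∈C refuted) with find (All.lookup M C∈ψ)
... | l , l∈C , l-true with l ≟L h
...   | yes refl = l-true
...   | no l≢h = ⊥-elim (compl-not-both a l l-true (forced-sound M (refuted l l∈C l≢h)))

forced-consistent : ∀ {ψ : CNF n m} {l} → Satisfiable ψ → Forced ψ l → Forced ψ (compl l) → ⊥
forced-consistent {l = l} (a , M) p q = compl-not-both a l (forced-sound M p) (forced-sound M q)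

forced-mono : ∀ {ψ ψ' : CNF n m} {h} → (∀ {E} → E ∈ ψ → E ∈ ψ') → Forced ψ h → Forced ψ' h
forced-mono ψ⊆ψ' (by C C∈ψ h∈C refuted) =
  by C (ψ⊆ψ' C∈ψ) h∈C (λ l l∈C l≢h → forced-mono ψ⊆ψ' (refuted l l∈C l≢h))

assumed-forced : ∀ {φ : CNF n m} (u : Lit n m) → Forced (assume u φ) u
assumed-forced u = by (u ∷ []) (here refl) (here refl) λ { l (here refl) u≢u → ⊥-elim (u≢u refl) }

-- A clause D derived by unit resolution is a sub-clause of a clause C ∈ ψ
-- all of whose literals outside D are refuted.
record Shortening (ψ : CNF n m) (D : Clause n m) : Set where
  constructor shortening
  field
    C : Clause n m
    C∈ψ : C ∈ ψ
    D⊆C : ∀ {l} → l ∈ D → l ∈ C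
    removed-refuted : ∀ l → l ∈ C → ¬ (l ∈ D) → Forced ψ (compl l)

-- Induction on the derivation; resolving with a derived unit l refutes ¬l.
UR→Shortening : ∀ {ψ : CNF n m} {D} → UR ψ D → Shortening ψ D
UR→Shortening (axiom {C} C∈ψ) =
  shortening C C∈ψ (λ l∈D → l∈D) (λ l l∈C l∉C → ⊥-elim (l∉C l∈C))
UR→Shortening {ψ = ψ} (resolve {l} {D} unit-l derived-D _)
  with UR→Shortening unit-l | UR→Shortening derived-D
... | shortening C₁ C₁∈ψ [l]⊆C₁ refuted₁ | shortening C₂ C₂∈ψ D⊆C₂ refuted₂ =
  shortening C₂ C₂∈ψ (λ k∈D' → D⊆C₂ (proj₁ (∈P.∈-filter⁻ keep? k∈D'))) refuted
  where
  keep? : ∀ k → Dec (k ≢ compl l)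
  keep? k = ¬? (k ≟L compl l)
  l-forced : Forced ψ l
  l-forced = by C₁ C₁∈ψ ([l]⊆C₁ (here refl))
    (λ k k∈C₁ k≢l → refuted₁ k k∈C₁ λ { (here k≡l) → k≢l k≡l ; (there ()) })
  refuted : ∀ k → k ∈ C₂ → ¬ (k ∈ removeLit (compl l) D) → Forced ψ (compl k)
  refuted k k∈C₂ k∉D' with k ≟L compl l
  ... | yes refl = subst (Forced ψ) (sym (compl-involutive l)) l-forced
  ... | no k≢¬l = refuted₂ k k∈C₂ (λ k∈D → k∉D' (∈P.∈-filter⁺ keep? k∈D k≢¬l))

UR→Forced : ∀ {ψ : CNF n m} {h} → UR ψ (h ∷ []) → Forced ψ h
UR→Forced derived with UR→Shortening derived
... | shortening C C∈ψ [h]⊆C refuted =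
  by C C∈ψ ([h]⊆C (here refl))
    (λ l l∈C l≢h → refuted l l∈C λ { (here l≡h) → l≢h l≡h ; (there ()) })

resolve-with : ∀ {ψ : CNF n m} {l D} → UR ψ (compl l ∷ []) → UR ψ D → l ∈ D → UR ψ (removeLit l D)
resolve-with {ψ = ψ} {l} {D} unit derived l∈D =
  subst (λ k → UR ψ (removeLit k D)) (compl-involutive l)
    (resolve unit derived (subst (_∈ D) (sym (compl-involutive l)) l∈D))

unique-singleton : ∀ {A : Set} {D : List A} {h} →
  Unique D → h ∈ D → (∀ {z} → z ∈ D → z ≡ h) → D ≡ h ∷ []
unique-singleton {D = a ∷ []} _ _ all-h = cong (_∷ []) (all-h (here refl))
unique-singleton {D = a ∷ b ∷ _} ((a≢b ∷ _) ∷ _) _ all-h =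
  ⊥-elim (a≢b (trans (all-h (here refl)) (sym (all-h (there (here refl))))))

-- Starting from a derived clause D ⊆ C containing h, resolve away, one by
-- one, the literals of the work list L (which contains every literal of D
-- other than h), each of which is refuted by hypothesis; the result is [h].
resolve-away : ∀ {ψ : CNF n m} (h : Lit n m) (C : Clause n m) →
  (∀ l → l ∈ C → l ≢ h → UR ψ (compl l ∷ [])) →
  (L : List (Lit n m)) (D : Clause n m) → UR ψ D → Unique D → h ∈ D →
  (∀ {z} → z ∈ D → z ∈ C) → (∀ {z} → z ∈ D → z ≢ h → z ∈ L) → UR ψ (h ∷ [])
resolve-away {ψ = ψ} h C refuted [] D derived unique h∈D D⊆C D⊆h∷L =
  subst (UR ψ) (unique-singleton unique h∈D only-h) derived
  where
  only-h : ∀ {z} → z ∈ D → z ≡ h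
  only-h {z} z∈D with z ≟L h
  ... | yes z≡h = z≡h
  ... | no z≢h with D⊆h∷L z∈D z≢h
  ... | ()
resolve-away {ψ = ψ} h C refuted (l ∷ L) D derived unique h∈D D⊆C D⊆h∷L
  with l ≟L h | l MemL.∈? D
... | yes l≡h | _ = resolve-away h C refuted L D derived unique h∈D D⊆C D⊆h∷L'
  where
  D⊆h∷L' : ∀ {z} → z ∈ D → z ≢ h → z ∈ L
  D⊆h∷L' z∈D z≢h with D⊆h∷L z∈D z≢h
  ... | here z≡l = ⊥-elim (z≢h (trans z≡l l≡h))
  ... | there z∈L = z∈L
... | no _ | no l∉D = resolve-away h C refuted L D derived unique h∈D D⊆C D⊆h∷L'
  where
  D⊆h∷L' : ∀ {z} → z ∈ D → z ≢ h → z ∈ L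
  D⊆h∷L' z∈D z≢h with D⊆h∷L z∈D z≢h
  ... | here refl = ⊥-elim (l∉D z∈D)
  ... | there z∈L = z∈L
... | no l≢h | yes l∈D =
  resolve-away h C refuted L (removeLit l D) (resolve-with (refuted l (D⊆C l∈D) l≢h) derived l∈D)
    (UniqueP.filter⁺ keep? unique) (∈P.∈-filter⁺ keep? h∈D (λ h≡l → l≢h (sym h≡l)))
    (λ z∈D' → D⊆C (proj₁ (∈P.∈-filter⁻ keep? z∈D'))) D'⊆h∷L
  where
  keep? : ∀ k → Dec (k ≢ l)
  keep? k = ¬? (k ≟L l)
  D'⊆h∷L : ∀ {z} → z ∈ removeLit l D → z ≢ h → z ∈ L
  D'⊆h∷L z∈D' z≢h with ∈P.∈-filter⁻ keep? z∈D'
  ... | z∈D , z≢l with D⊆h∷L z∈D z≢h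
  ... | here z≡l = ⊥-elim (z≢l z≡l)
  ... | there z∈L = z∈L

Forced→UR : ∀ {ψ : CNF n m} {h} → All Unique ψ → Forced ψ h → UR ψ (h ∷ [])
Forced→UR uniques (by {h} C C∈ψ h∈C refuted) =
  resolve-away h C (λ l l∈C l≢h → Forced→UR uniques (refuted l l∈C l≢h))
    C C (axiom C∈ψ) (All.lookup uniques C∈ψ) h∈C (λ z∈C → z∈C) (λ z∈C _ → z∈C)

dedup : Clause n m → Clause n m
dedup = deduplicate _≟L_

dedup⁻ : ∀ {l} {E : Clause n m} → l ∈ dedup E → l ∈ E
dedup⁻ = AnyP.deduplicate⁻ _≟L_

dedup⁺ : ∀ {l} {E : Clause n m} → l ∈ E → l ∈ dedup E
dedup⁺ = AnyP.deduplicate⁺ _≟L_ (λ e p → trans p (sym e))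

dedup-length : (E : Clause n m) → length (dedup E) ≤ length E
dedup-length [] = z≤n
dedup-length (l ∷ E) = s≤s (ℕP.≤-trans (ListP.length-filter _ (dedup E)) (dedup-length E))

dedup-≈ : (E : Clause n m) → E ≈C dedup E
dedup-≈ E l = dedup⁺ , dedup⁻

≈C-trans : {C D E : Clause n m} → C ≈C D → D ≈C E → C ≈C E
≈C-trans p q l = (λ k → proj₁ (q l) (proj₁ (p l) k)) , (λ k → proj₂ (p l) (proj₂ (q l) k))

Tautology : Clause n m → Set
Tautology E = Any (λ l → compl l ∈ E) E

tautology? : (E : Clause n m) → Dec (Tautology E)
tautology? E = any? (λ l → compl l MemL.∈? E) E

_≈C?_ : (C D : Clause n m) → Dec (C ≈C D)
C ≈C? D with all? (MemL._∈? D) C | all? (MemL._∈? C) D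
... | yes C⊆D | yes D⊆C = yes λ l → All.lookup C⊆D , All.lookup D⊆C
... | no C⊈D | _ = no λ C≈D → C⊈D (All.tabulate λ l∈C → proj₁ (C≈D _) l∈C)
... | yes _ | no D⊈C = no λ C≈D → D⊈C (All.tabulate λ l∈D → proj₂ (C≈D _) l∈D)

normalise : CNF n m → CNF n m
normalise [] = []
normalise (E ∷ ψ) with tautology? E
... | yes _ = normalise ψ
... | no _ with any? (dedup E ≈C?_) (normalise ψ)
... | yes _ = normalise ψ
... | no _ = dedup E ∷ normalise ψ

normalise-size : (ψ : CNF n m) → size (normalise ψ) ≤ size ψ
normalise-size [] = z≤n
normalise-size (E ∷ ψ) with tautology? E
... | yes _ = ℕP.m≤n⇒m≤1+n (normalise-size ψ)
... | no _ with any? (dedup E ≈C?_) (normalise ψ)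
... | yes _ = ℕP.m≤n⇒m≤1+n (normalise-size ψ)
... | no _ = s≤s (normalise-size ψ)

normalise-WF : (ψ : CNF n m) → WF (normalise ψ)
normalise-WF [] = [] , []
normalise-WF (E ∷ ψ) with tautology? E
... | yes _ = normalise-WF ψ
... | no not-taut with any? (dedup E ≈C?_) (normalise ψ)
... | yes _ = normalise-WF ψ
... | no fresh =
  (well-formed ∷ proj₁ (normalise-WF ψ)) , (AllP.¬Any⇒All¬ _ fresh ∷ proj₂ (normalise-WF ψ))
  where
  well-formed : WFClause (dedup E)
  well-formed =
    UniqueDecP.deduplicate-! _≟L_ E , λ l l∈ ¬l∈ → not-taut (lose (dedup⁻ l∈) (dedup⁻ ¬l∈))

normalise-models : ∀ {a : Var n m → Bool} (ψ : CNF n m) → Models a ψ → Models a (normalise ψ)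
normalise-models [] M = []
normalise-models (E ∷ ψ) (sat ∷ M) with tautology? E
... | yes _ = normalise-models ψ M
... | no _ with any? (dedup E ≈C?_) (normalise ψ)
... | yes _ = normalise-models ψ M
... | no _ with find sat
... | l , l∈E , l-true = lose (dedup⁺ l∈E) l-true ∷ normalise-models ψ M

normalise-2CNF : (ψ : CNF n m) → Is2CNF ψ → Is2CNF (normalise ψ)
normalise-2CNF [] T = []
normalise-2CNF (E ∷ ψ) (short ∷ T) with tautology? E
... | yes _ = normalise-2CNF ψ T
... | no _ with any? (dedup E ≈C?_) (normalise ψ)
... | yes _ = normalise-2CNF ψ T
... | no _ = ℕP.≤-trans (dedup-length E) short ∷ normalise-2CNF ψ T

Covers : CNF n m → CNF n m → Set
Covers ψ ψ' = ∀ {E} → E ∈ ψ → Tautology E ⊎ (Σ _ λ E' → E' ∈ ψ' × E ≈C E')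

normalise-covers : (ψ : CNF n m) → Covers ψ (normalise ψ)
normalise-covers [] ()
normalise-covers (E ∷ ψ) E'∈ with tautology? E
normalise-covers (E ∷ ψ) (here refl) | yes taut = inj₁ taut
normalise-covers (E ∷ ψ) (there E'∈) | yes _ = normalise-covers ψ E'∈
normalise-covers (E ∷ ψ) E'∈ | no _ with any? (dedup E ≈C?_) (normalise ψ)
normalise-covers (E ∷ ψ) (here refl) | no _ | yes old with find old
... | D , D∈ , E≈D = inj₂ (D , D∈ , ≈C-trans (dedup-≈ E) E≈D)
normalise-covers (E ∷ ψ) (there E'∈) | no _ | yes _ = normalise-covers ψ E'∈
normalise-covers (E ∷ ψ) (here refl) | no _ | no _ = inj₂ (dedup E , here refl , dedup-≈ E)
normalise-covers (E ∷ ψ) (there E'∈) | no _ | no _ with normalise-covers ψ E'∈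
... | inj₁ taut = inj₁ taut
... | inj₂ (D , D∈ , E≈D) = inj₂ (D , there D∈ , E≈D)

covers-assume : ∀ {ψ ψ' : CNF n m} (u : Lit n m) → Covers ψ ψ' → Covers (assume u ψ) (assume u ψ')
covers-assume u cover (here refl) = inj₂ (u ∷ [] , here refl , λ l → (λ k → k) , (λ k → k))
covers-assume u cover (there E∈) with cover E∈
... | inj₁ taut = inj₁ taut
... | inj₂ (D , D∈ , E≈D) = inj₂ (D , there D∈ , E≈D)

-- Forcing transfers to a covering formula, provided ψ is satisfiable: a
-- tautology {l, ¬l, …} can only force l by refuting ¬l (or vice versa), and
-- refuting any third literal would force both l and ¬l.
forced-transfer : ∀ {ψ ψ' : CNF n m} {h} → Satisfiable ψ → Covers ψ ψ' → Forced ψ h → Forced ψ' h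
forced-transfer {ψ = ψ} {ψ'} {h} sat cover (by E E∈ h∈E refuted) with cover E∈
... | inj₂ (E' , E'∈ , E≈E') =
  by E' E'∈ (proj₁ (E≈E' h) h∈E)
    (λ l l∈E' l≢h → forced-transfer sat cover (refuted l (proj₂ (E≈E' l) l∈E') l≢h))
... | inj₁ taut with find taut
... | l , l∈E , ¬l∈E with l ≟L h | compl l ≟L h
...   | yes refl | _ = subst (Forced ψ') (compl-involutive l)
                         (forced-transfer sat cover (refuted (compl l) ¬l∈E (compl-≢ l)))
...   | no l≢h | yes refl = forced-transfer sat cover (refuted l l∈E l≢h)
...   | no l≢h | no ¬l≢h = ⊥-elim (forced-consistent sat
          (subst (Forced ψ) (compl-involutive l) (refuted (compl l) ¬l∈E ¬l≢h)) (refuted l l∈E l≢h))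

-- The P-encoding properties stated through forcing.  The reductions below
-- only preserve these; normalisation then restores a well-formed P-encoding.
ForcedPEncoding : CNF n m → Set
ForcedPEncoding {n} χ =
  (∀ (j : Fin n) → Satisfiable (assume (pos (x j)) χ)) ×
  (∀ (j k : Fin n) → j ≢ k → Forced (assume (pos (x j)) χ) (neg (x k)))

PEncoding→Forced : {φ : CNF n m} → IsPEncoding φ → ForcedPEncoding φ
PEncoding→Forced (sat , derive) = sat , λ j k j≢k → UR→Forced (derive j k j≢k)

-- Normalising yields a P-encoding: models survive, forcing survives by
-- forced-transfer, and it is UR since the new clauses are duplicate-free.
normalise-PEncoding : (χ : CNF n m) → ForcedPEncoding χ → IsPEncoding (normalise χ)
normalise-PEncoding χ (sat , forced) = sat′ , derive
  where
  sat′ : ∀ j → Satisfiable (assume (pos (x j)) (normalise χ))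
  sat′ j with sat j
  ... | a , (unit-true ∷ M) = a , (unit-true ∷ normalise-models χ M)
  derive : ∀ j k → j ≢ k → normalise χ ∧ pos (x j) ⊢₁ neg (x k)
  derive j k j≢k =
    Forced→UR (([] ∷ []) ∷ All.map proj₁ (proj₁ (normalise-WF χ)))
      (forced-transfer (sat j) (covers-assume _ (normalise-covers χ)) (forced j k j≢k))

Shrinks : ℕ → ℕ → CNF n m → Set
Shrinks n' k φ = Σ ℕ λ m' → Σ (CNF n' m') λ φ' →
  WF φ' × IsPEncoding φ' × size φ' + k ≤ size φ × (Is2CNF φ → Is2CNF φ')

shrinks-by-normalising : ∀ {n' m' k} {φ : CNF n m} (χ : CNF n' m') → ForcedPEncoding χ →
  size χ + k ≤ size φ → (Is2CNF φ → Is2CNF χ) → Shrinks n' k φ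
shrinks-by-normalising {m' = m'} χ encodes smaller two-CNF =
  m' , normalise χ , normalise-WF χ , normalise-PEncoding χ encodes ,
  ℕP.≤-trans (ℕP.+-monoˡ-≤ _ (normalise-size χ)) smaller , λ T → normalise-2CNF χ (two-CNF T)

¬x∈? : (i : Fin n) (C : Clause n m) → Dec (neg (x i) ∈ C)
¬x∈? i C = neg (x i) MemL.∈? C

Qᶜ : CNF n m → Fin n → CNF n m
Qᶜ φ i = filter (λ C → ¬? (¬x∈? i C)) φ

length-split : ∀ {A : Set} {P : A → Set} (P? : Decidable P) (xs : List A) →
  length (filter P? xs) + length (filter (λ z → ¬? (P? z)) xs) ≡ length xs
length-split P? [] = refl
length-split P? (y ∷ ys) with P? y
... | yes _ = cong suc (length-split P? ys)
... | no _ = trans (ℕP.+-suc _ _) (cong suc (length-split P? ys))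

rewrite-Qᶜ-size : ∀ {n' m'} (f : Clause n m → Clause n' m') (φ : CNF n m) (i : Fin n) →
  size (map f (Qᶜ φ i)) + size (Q φ i) ≡ size φ
rewrite-Qᶜ-size f φ i =
  trans (cong (_+ size (Q φ i)) (ListP.length-map f (Qᶜ φ i)))
    (trans (ℕP.+-comm (size (Qᶜ φ i)) _) (length-split (¬x∈? i) φ))

rewrite-Qᶜ-∈ : ∀ {n' m'} (f : Clause n m → Clause n' m') {φ : CNF n m} {i C} →
  C ∈ φ → ¬ (neg (x i) ∈ C) → f C ∈ map f (Qᶜ φ i)
rewrite-Qᶜ-∈ f {i = i} C∈φ ¬xᵢ∉C =
  ∈P.∈-map⁺ f (∈P.∈-filter⁺ (λ C → ¬? (¬x∈? i C)) C∈φ ¬xᵢ∉C)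

rewrite-Qᶜ-tabulate : ∀ {n' m'} (f : Clause n m → Clause n' m') {φ : CNF n m} {i}
  {P : Clause n' m' → Set} → (∀ {C} → C ∈ φ → ¬ (neg (x i) ∈ C) → P (f C)) →
  All P (map f (Qᶜ φ i))
rewrite-Qᶜ-tabulate f {φ} {i} {P} P-of-f = All.tabulate from-Qᶜ
  where
  from-Qᶜ : ∀ {D} → D ∈ map f (Qᶜ φ i) → P D
  from-Qᶜ D∈ with ∈P.∈-map⁻ f D∈
  ... | C , C∈ , refl with ∈P.∈-filter⁻ (λ C → ¬? (¬x∈? i C)) {xs = φ} C∈
  ... | C∈φ , ¬xᵢ∉C = P-of-f C∈φ ¬xᵢ∉C

rewrite-Qᶜ-2CNF : ∀ {n' m'} (f : Clause n m → Clause n' m') {φ : CNF n m} {i} →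
  (∀ C → length (f C) ≤ length C) → Is2CNF φ → Is2CNF (map f (Qᶜ φ i))
rewrite-Qᶜ-2CNF f shorter T =
  rewrite-Qᶜ-tabulate f λ {C} C∈φ _ → ℕP.≤-trans (shorter C) (All.lookup T C∈φ)

-- A pivot clause for xᵢ: a clause E ∋ ¬xᵢ with a literal ℓ ≠ ¬xᵢ all of
-- whose other literals are refuted by φ alone, so that assuming xᵢ forces ℓ.
record Pivot (φ : CNF n m) (i : Fin n) : Set where
  constructor pivot
  field
    E : Clause n m
    E∈φ : E ∈ φ
    ¬xᵢ∈E : neg (x i) ∈ E
    ℓ : Lit n m
    ℓ∈E : ℓ ∈ E
    ℓ≢¬xᵢ : ℓ ≢ neg (x i)
    others-refuted : ∀ l → l ∈ E → l ≢ neg (x i) → l ≢ ℓ → Forced φ (compl l)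

all-or-witness : ∀ {A B : Set} {P Q : A → Set} (P? : Decidable P) (xs : List A) →
  (∀ a → a ∈ xs → P a → Q a ⊎ B) → (∀ a → a ∈ xs → P a → Q a) ⊎ B
all-or-witness P? [] f = inj₁ λ a ()
all-or-witness P? (y ∷ ys) f with all-or-witness P? ys (λ a a∈ys → f a (there a∈ys))
... | inj₂ b = inj₂ b
... | inj₁ all-Q with P? y
...   | no ¬Py = inj₁ λ { a (here refl) Pa → ⊥-elim (¬Py Pa) ; a (there a∈ys) Pa → all-Q a a∈ys Pa }
...   | yes Py with f y (here refl) Py
...     | inj₂ b = inj₂ b
...     | inj₁ Qy = inj₁ λ { a (here refl) Pa → Qy ; a (there a∈ys) Pa → all-Q a a∈ys Pa }

forced-under-xᵢ : ∀ (φ : CNF n m) (i : Fin n) {h} → Satisfiable (assume (pos (x i)) φ) →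
  Forced (assume (pos (x i)) φ) h → Forced φ h ⊎ h ≡ pos (x i) ⊎ Pivot φ i
forced-under-xᵢ φ i sat (by E (here refl) (here h≡xᵢ) _) = inj₂ (inj₁ h≡xᵢ)
forced-under-xᵢ φ i {h} sat (by E (there E∈φ) h∈E refuted) with ¬x∈? i E
... | yes ¬xᵢ∈E with h ≟L neg (x i)
...   | yes refl = ⊥-elim (forced-consistent sat (by E (there E∈φ) h∈E refuted) (assumed-forced (pos (x i))))
...   | no h≢¬xᵢ with all-or-witness (λ l → ¬? (l ≟L h) ×-dec ¬? (l ≟L neg (x i))) E recurse
  where
  recurse : ∀ l → l ∈ E → l ≢ h × l ≢ neg (x i) → Forced φ (compl l) ⊎ Pivot φ i
  recurse l l∈E (l≢h , l≢¬xᵢ) with forced-under-xᵢ φ i sat (refuted l l∈E l≢h)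
  ... | inj₁ forced = inj₁ forced
  ... | inj₂ (inj₁ ¬l≡xᵢ) = ⊥-elim (l≢¬xᵢ (compl-injective ¬l≡xᵢ))
  ... | inj₂ (inj₂ P) = inj₂ P
...     | inj₂ P = inj₂ (inj₂ P)
...     | inj₁ all-refuted =
  inj₂ (inj₂ (pivot E E∈φ ¬xᵢ∈E h h∈E h≢¬xᵢ
    λ l l∈E l≢¬xᵢ l≢h → all-refuted l l∈E (l≢h , l≢¬xᵢ)))
forced-under-xᵢ φ i {h} sat (by E (there E∈φ) h∈E refuted) | no ¬xᵢ∉E
  with all-or-witness (λ l → ¬? (l ≟L h)) E recurse
  where
  recurse : ∀ l → l ∈ E → l ≢ h → Forced φ (compl l) ⊎ Pivot φ i
  recurse l l∈E l≢h with forced-under-xᵢ φ i sat (refuted l l∈E l≢h)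
  ... | inj₁ forced = inj₁ forced
  ... | inj₂ (inj₁ ¬l≡xᵢ) = ⊥-elim (¬xᵢ∉E (subst (_∈ E) (compl-injective ¬l≡xᵢ) l∈E))
  ... | inj₂ (inj₂ P) = inj₂ P
... | inj₂ P = inj₂ (inj₂ P)
... | inj₁ all-refuted = inj₁ (by E E∈φ h∈E all-refuted)

-- Every input of a P-encoding with a second input xⱼ has a pivot clause:
-- xᵢ forces ¬xⱼ, which φ alone cannot force, as φ ∧ xⱼ is satisfiable.
pivot-exists : {φ : CNF n m} → ForcedPEncoding φ → (i j : Fin n) → j ≢ i → Pivot φ i
pivot-exists {φ = φ} (sat , forced) i j j≢i
  with forced-under-xᵢ φ i (sat i) (forced i j (λ i≡j → j≢i (sym i≡j)))
... | inj₁ ¬xⱼ-forced =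
  ⊥-elim (forced-consistent (sat j) (assumed-forced (pos (x j))) (forced-mono there ¬xⱼ-forced))
... | inj₂ (inj₁ ())
... | inj₂ (inj₂ P) = P

no-members : ∀ {A : Set} {xs : List A} {a : A} → length xs ≡ 0 → ¬ (a ∈ xs)
no-members {xs = []} _ ()

pivot-in-Q : {φ : CNF n m} {i : Fin n} → Pivot φ i → size (Q φ i) ≢ 0
pivot-in-Q {i = i} P |Q|≡0 =
  no-members |Q|≡0 (∈P.∈-filter⁺ (¬x∈? i) (Pivot.E∈φ P) (Pivot.¬xᵢ∈E P))

varOf : Lit n m → Var n m
varOf (pos v) = v
varOf (neg v) = v

lit : Bool → Var n m → Lit n m
lit true v = pos v
lit false v = neg v

eval-compl : (a : Var n m → Bool) (l : Lit n m) → evalLit a (compl l) ≡ not (evalLit a l)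
eval-compl a (pos v) = refl
eval-compl a (neg v) = sym (not-involutive (a v))

raise : (Var n m → Bool) → Var n m → Var n m → Bool
raise a v w with w ≟V v
... | yes _ = true
... | no _ = a w

raise-eval : (a : Var n m → Bool) (v : Var n m) (l : Lit n m) → varOf l ≢ v →
  evalLit (raise a v) l ≡ evalLit a l
raise-eval a v (pos w) w≢v with w ≟V v
... | yes w≡v = ⊥-elim (w≢v w≡v)
... | no _ = refl
raise-eval a v (neg w) w≢v with w ≟V v
... | yes w≡v = ⊥-elim (w≢v w≡v)
... | no _ = refl

raise-true : (a : Var n m → Bool) (v : Var n m) → evalLit (raise a v) (pos v) ≡ true
raise-true a v with v ≟V v
... | yes _ = refl
... | no v≢v = ⊥-elim (v≢v refl)

raise-model : ∀ {ψ : CNF n m} (a : Var n m → Bool) (v : Var n m) → a v ≡ false → Models a ψ →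
  (∀ {C} → C ∈ ψ → neg v ∈ C → ∃ λ l → l ∈ C × varOf l ≢ v × evalLit a l ≡ true) →
  Models (raise a v) ψ
raise-model {ψ = ψ} a v v-false M escape = All.tabulate satisfied
  where
  satisfied : ∀ {C} → C ∈ ψ → Any (λ l → evalLit (raise a v) l ≡ true) C
  satisfied {C} C∈ψ with neg v MemL.∈? C
  ... | yes ¬v∈C with escape C∈ψ ¬v∈C
  ...   | l , l∈C , l-off-v , l-true = lose l∈C (trans (raise-eval a v l l-off-v) l-true)
  satisfied {C} C∈ψ | no ¬v∉C with find (All.lookup M C∈ψ)
  ... | l , l∈C , l-true = lose l∈C (trans (raise-eval a v l (off-v l l∈C l-true)) l-true)
    where
    off-v : ∀ l → l ∈ C → evalLit a l ≡ true → varOf l ≢ v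
    off-v (pos _) _ l-true refl with trans (sym l-true) v-false
    ... | ()
    off-v (neg _) l∈C _ refl = ¬v∉C l∈C

module Substitution {n m : ℕ} (i : Fin n) (y : Fin m) (b : Bool) where

  σᵥ : Var n m → Lit n m
  σᵥ v with v ≟V inj₂ y
  ... | yes _ = lit b (x i)
  ... | no _ = pos v

  σ : Lit n m → Lit n m
  σ (pos v) = σᵥ v
  σ (neg v) = compl (σᵥ v)

  σ-compl : (l : Lit n m) → σ (compl l) ≡ compl (σ l)
  σ-compl (pos v) = refl
  σ-compl (neg v) = sym (compl-involutive (σᵥ v))

  σᵥ-y : σᵥ (inj₂ y) ≡ lit b (x i)
  σᵥ-y with inj₂ {A = Fin n} y ≟V inj₂ y
  ... | yes _ = refl
  ... | no y≢y = ⊥-elim (y≢y refl)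

  σ-lit : σ (lit b (inj₂ y)) ≡ pos (x i)
  σ-lit = on-polarity b σᵥ-y
    where
    on-polarity : ∀ c → σᵥ (inj₂ y) ≡ lit c (x i) → σ (lit c (inj₂ y)) ≡ pos (x i)
    on-polarity true e = e
    on-polarity false e = cong compl e

  σ-eval : (a : Var n m → Bool) → a (x i) ≡ evalLit a (lit b (inj₂ y)) →
    (l : Lit n m) → evalLit a (σ l) ≡ evalLit a l
  σ-eval a agree (pos v) = σᵥ-eval v
    where
    σᵥ-eval : ∀ v → evalLit a (σᵥ v) ≡ a v
    σᵥ-eval v with v ≟V inj₂ y
    ... | no _ = refl
    ... | yes refl = swap b agree
      where
      swap : ∀ c → a (x i) ≡ evalLit a (lit c (inj₂ y)) → evalLit a (lit c (x i)) ≡ a (inj₂ y)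
      swap true e = e
      swap false e = trans (cong not e) (not-involutive (a (inj₂ y)))
  σ-eval a agree (neg v) = trans (eval-compl a (σᵥ v)) (cong not (σ-eval a agree (pos v)))

auxiliary-literal : (l : Lit n m) → (∀ k → l ≢ pos (x k)) → (∀ k → l ≢ neg (x k)) →
  ∃ λ y → ∃ λ b → l ≡ lit b (inj₂ y)
auxiliary-literal (pos (inj₁ k)) not-pos _ = ⊥-elim (not-pos k refl)
auxiliary-literal (neg (inj₁ k)) _ not-neg = ⊥-elim (not-neg k refl)
auxiliary-literal (pos (inj₂ y)) _ _ = y , true , refl
auxiliary-literal (neg (inj₂ y)) _ _ = y , false , refl

singleton-members : ∀ {A : Set} {xs : List A} {a b : A} → length xs ≡ 1 → a ∈ xs → b ∈ xs → a ≡ b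
singleton-members {xs = _ ∷ []} _ (here refl) (here refl) = refl

module UniquePivot {n m : ℕ} (φ : CNF n m) (i : Fin n) (P : Pivot φ i)
  (encodes : ForcedPEncoding φ) (|Q|≡1 : size (Q φ i) ≡ 1) where

  open Pivot P

  sat : ∀ j → Satisfiable (assume (pos (x j)) φ)
  sat = proj₁ encodes

  ¬x-forced : ∀ j k → j ≢ k → Forced (assume (pos (x j)) φ) (neg (x k))
  ¬x-forced = proj₂ encodes

  only-E : ∀ {E'} → E' ∈ φ → neg (x i) ∈ E' → E' ≡ E
  only-E E'∈φ ¬xᵢ∈E' =
    singleton-members |Q|≡1
      (∈P.∈-filter⁺ (¬x∈? i) E'∈φ ¬xᵢ∈E') (∈P.∈-filter⁺ (¬x∈? i) E∈φ ¬xᵢ∈E)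

  ℓ-forced : Forced (assume (pos (x i)) φ) ℓ
  ℓ-forced = by E (there E∈φ) ℓ∈E refuted
    where
    refuted : ∀ l → l ∈ E → l ≢ ℓ → Forced (assume (pos (x i)) φ) (compl l)
    refuted l l∈E l≢ℓ with l ≟L neg (x i)
    ... | yes refl = assumed-forced (pos (x i))
    ... | no l≢¬xᵢ = forced-mono there (others-refuted l l∈E l≢¬xᵢ l≢ℓ)

  -- E is the only clause through which xᵢ propagates, so whatever xᵢ forces,
  -- apart from xᵢ itself, is already forced by ℓ.
  forced-via-ℓ : ∀ {h} → Forced (assume (pos (x i)) φ) h → Forced (assume ℓ φ) h ⊎ h ≡ pos (x i)
  forced-via-ℓ (by _ (here refl) (here h≡xᵢ) _) = inj₂ h≡xᵢ
  forced-via-ℓ {h} h-forced@(by E' (there E'∈φ) h∈E' refuted) with ¬x∈? i E'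
  ... | yes ¬xᵢ∈E' with only-E E'∈φ ¬xᵢ∈E'
  ...   | refl with h ≟L neg (x i) | h ≟L ℓ
  ...     | yes refl | _ = ⊥-elim (forced-consistent (sat i) h-forced (assumed-forced (pos (x i))))
  ...     | no _ | yes refl = inj₁ (assumed-forced h)
  ...     | no h≢¬xᵢ | no h≢ℓ =
    ⊥-elim (forced-consistent (sat i) h-forced (forced-mono there (others-refuted h h∈E' h≢¬xᵢ h≢ℓ)))
  forced-via-ℓ {h} (by E' (there E'∈φ) h∈E' refuted) | no ¬xᵢ∉E' =
    inj₁ (by E' (there E'∈φ) h∈E' refuted′)
    where
    refuted′ : ∀ l → l ∈ E' → l ≢ h → Forced (assume ℓ φ) (compl l)
    refuted′ l l∈E' l≢h with forced-via-ℓ (refuted l l∈E' l≢h)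
    ... | inj₁ forced = forced
    ... | inj₂ ¬l≡xᵢ = ⊥-elim (¬xᵢ∉E' (subst (_∈ E') (compl-injective ¬l≡xᵢ) l∈E'))

  -- ℓ is not a positive input literal: ℓ = xᵢ would make E a tautology,
  -- and ℓ = xₖ (k ≠ i) would be forced together with ¬xₖ by xᵢ.
  ℓ-not-positive : WF φ → ∀ k → ℓ ≢ pos (x k)
  ℓ-not-positive wf k ℓ≡xₖ with k FinP.≟ i
  ... | yes refl = proj₂ (All.lookup (proj₁ wf) E∈φ) (neg (x i)) ¬xᵢ∈E (subst (_∈ E) ℓ≡xₖ ℓ∈E)
  ... | no k≢i =
    forced-consistent (sat i) (subst (Forced _) ℓ≡xₖ ℓ-forced) (¬x-forced i k (λ i≡k → k≢i (sym i≡k)))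

  -- ℓ is not a negative input literal: for ℓ = ¬xₖ (k ≠ i) and a third
  -- input xₜ, xᵢ forces ¬xₜ, hence so does ¬xₖ; but a model of φ ∧ xₜ
  -- satisfies ¬xₖ.
  ℓ-not-negative : (∀ k → ∃ λ t → t ≢ i × t ≢ k) → ∀ k → ℓ ≢ neg (x k)
  ℓ-not-negative third k ℓ≡¬xₖ with k FinP.≟ i | third k
  ... | yes refl | _ = ℓ≢¬xᵢ ℓ≡¬xₖ
  ... | no _ | t , t≢i , t≢k
    with forced-via-ℓ (¬x-forced i t (λ i≡t → t≢i (sym i≡t))) | sat t
  ...   | inj₂ () | _
  ...   | inj₁ ¬xₜ-by-ℓ | a , M@(here xₜ-true ∷ φ-true) =
    compl-not-both a (pos (x t)) xₜ-true (forced-sound (here ℓ-true ∷ φ-true) ¬xₜ-by-ℓ)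
    where
    ℓ-true : evalLit a ℓ ≡ true
    ℓ-true = subst (λ l → evalLit a l ≡ true) (sym ℓ≡¬xₖ) (forced-sound M (¬x-forced t k t≢k))

  module Substitute (y : Fin m) (b : Bool) (ℓ≡ : ℓ ≡ lit b (inj₂ y)) where
    open Substitution i y b

    χ : CNF n m
    χ = map (map σ) (Qᶜ φ i)

    σℓ : σ ℓ ≡ pos (x i)
    σℓ = trans (cong σ ℓ≡) σ-lit

    σ¬ℓ : σ (compl ℓ) ≡ neg (x i)
    σ¬ℓ = trans (σ-compl ℓ) (cong compl σℓ)

    -- A way to transport a forcing step through E from the assumption u,
    -- given the original and the transported refutations of its other literals.
    ThroughE : Lit n m → Set
    ThroughE u = ∀ {h} → h ∈ E →
      (∀ l → l ∈ E → l ≢ h → Forced (assume u φ) (compl l)) →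
      (∀ l → l ∈ E → l ≢ h → Forced (assume (σ u) χ) (σ (compl l))) →
      Forced (assume (σ u) χ) (σ h)

    translate : ∀ (u : Lit n m) → ThroughE u →
      ∀ {h} → Forced (assume u φ) h → Forced (assume (σ u) χ) (σ h)
    translate u through-E (by _ (here refl) (here refl) _) = assumed-forced (σ u)
    translate u through-E {h} (by E' (there E'∈φ) h∈E' refuted) with ¬x∈? i E'
    ... | yes ¬xᵢ∈E' with only-E E'∈φ ¬xᵢ∈E'
    ...   | refl = through-E h∈E' refuted (λ l l∈E l≢h → translate u through-E (refuted l l∈E l≢h))
    translate u through-E {h} (by E' (there E'∈φ) h∈E' refuted) | no ¬xᵢ∉E' =
      by (map σ E') (there (rewrite-Qᶜ-∈ (map σ) E'∈φ ¬xᵢ∉E')) (∈P.∈-map⁺ σ h∈E') refuted′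
      where
      refuted′ : ∀ l → l ∈ map σ E' → l ≢ σ h → Forced (assume (σ u) χ) (compl l)
      refuted′ l l∈ l≢σh with ∈P.∈-map⁻ σ l∈
      ... | l₀ , l₀∈E' , refl = subst (Forced _) (σ-compl l₀)
              (translate u through-E (refuted l₀ l₀∈E' (λ l₀≡h → l≢σh (cong σ l₀≡h))))

    -- From xⱼ (j ≠ i), E can only force ¬xᵢ = σ(¬ℓ): refuting ¬xᵢ would
    -- contradict ¬xᵢ being forced.
    translate-other : ∀ j → j ≢ i →
      ∀ {h} → Forced (assume (pos (x j)) φ) h → Forced (assume (pos (x j)) χ) (σ h)
    translate-other j j≢i = translate (pos (x j)) through-E
      where
      through-E : ThroughE (pos (x j))
      through-E {h} h∈E refuted refuted′ with h ≟L neg (x i)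
      ... | yes refl = subst (Forced _) σ¬ℓ (refuted′ ℓ ℓ∈E ℓ≢¬xᵢ)
      ... | no h≢¬xᵢ = ⊥-elim (forced-consistent (sat j)
              (refuted (neg (x i)) ¬xᵢ∈E (λ ¬xᵢ≡h → h≢¬xᵢ (sym ¬xᵢ≡h))) (¬x-forced j i j≢i))

    -- From xᵢ, E can only force ℓ, and σ(ℓ) = xᵢ is assumed.
    translate-i : ∀ {h} → Forced (assume (pos (x i)) φ) h → Forced (assume (pos (x i)) χ) (σ h)
    translate-i = translate (pos (x i)) through-E
      where
      through-E : ThroughE (pos (x i))
      through-E {h} h∈E refuted _ with h ≟L ℓ
      ... | yes refl = subst (Forced _) (sym σℓ) (assumed-forced (pos (x i)))
      ... | no h≢ℓ =
        ⊥-elim (forced-consistent (sat i) ℓ-forced (refuted ℓ ℓ∈E (λ ℓ≡h → h≢ℓ (sym ℓ≡h))))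

    χ-forces : ∀ j k → j ≢ k → Forced (assume (pos (x j)) χ) (neg (x k))
    χ-forces j k j≢k with j FinP.≟ i
    ... | yes refl = translate-i (¬x-forced j k j≢k)
    ... | no j≢i = translate-other j j≢i (¬x-forced j k j≢k)

    ℓ-off-xᵢ : varOf ℓ ≢ x i
    ℓ-off-xᵢ = subst (λ l → varOf l ≢ x i) (sym ℓ≡) (auxiliary-off b)
      where
      auxiliary-off : ∀ c → varOf (lit {n} {m} c (inj₂ y)) ≢ x i
      auxiliary-off true ()
      auxiliary-off false ()

    -- For j ≠ i both are
    -- false: xᵢ is forced false, and if ℓ were true, raising xᵢ would give a
    -- model (E being satisfied by ℓ) in which the forced ¬xᵢ fails.
    xᵢ-agrees-with-ℓ : ∀ j (a : Var n m → Bool) → Models a (assume (pos (x j)) φ) →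
      a (x i) ≡ evalLit a ℓ
    xᵢ-agrees-with-ℓ j a M with j FinP.≟ i
    ... | yes refl = trans (forced-sound M (assumed-forced (pos (x i)))) (sym (forced-sound M ℓ-forced))
    ... | no j≢i = trans xᵢ-false (sym ℓ-false)
      where
      xᵢ-false : a (x i) ≡ false
      xᵢ-false = trans (sym (not-involutive (a (x i)))) (cong not (forced-sound M (¬x-forced j i j≢i)))
      ℓ-false : evalLit a ℓ ≡ false
      ℓ-false with evalLit a ℓ in ℓ-value
      ... | false = refl
      ... | true = ⊥-elim (compl-not-both (raise a (x i)) (pos (x i)) (raise-true a (x i))
                     (forced-sound (raise-model a (x i) xᵢ-false M escape) (¬x-forced j i j≢i)))
        where
        escape : ∀ {C} → C ∈ assume (pos (x j)) φ → neg (x i) ∈ C →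
          ∃ λ l → l ∈ C × varOf l ≢ x i × evalLit a l ≡ true
        escape (here refl) (here ())
        escape (here refl) (there ())
        escape (there C∈φ) ¬xᵢ∈C with only-E C∈φ ¬xᵢ∈C
        ... | refl = ℓ , ℓ∈E , ℓ-off-xᵢ , ℓ-value

    χ-sat : ∀ j → Satisfiable (assume (pos (x j)) χ)
    χ-sat j with sat j
    ... | a , M@(xⱼ-true ∷ φ-true) = a , (xⱼ-true ∷ rewrite-Qᶜ-tabulate (map σ) σ-clause)
      where
      agree : a (x i) ≡ evalLit a (lit b (inj₂ y))
      agree = trans (xᵢ-agrees-with-ℓ j a M) (cong (evalLit a) ℓ≡)
      σ-clause : ∀ {C} → C ∈ φ → ¬ (neg (x i) ∈ C) → Any (λ l → evalLit a l ≡ true) (map σ C)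
      σ-clause C∈φ _ with find (All.lookup φ-true C∈φ)
      ... | l , l∈C , l-true = lose (∈P.∈-map⁺ σ l∈C) (trans (σ-eval a agree l) l-true)

    shrinks : Shrinks n 1 φ
    shrinks = shrinks-by-normalising χ (χ-sat , χ-forces) smaller
                (rewrite-Qᶜ-2CNF (map σ) (λ C → ℕP.≤-reflexive (ListP.length-map σ C)))
      where
      smaller : size χ + 1 ≤ size φ
      smaller = ℕP.≤-reflexive (trans (cong (size χ +_) (sym |Q|≡1)) (rewrite-Qᶜ-size (map σ) φ i))

  shrinks : WF φ → (∀ k → ∃ λ t → t ≢ i × t ≢ k) → Shrinks n 1 φ
  shrinks wf third with auxiliary-literal ℓ (ℓ-not-positive wf) (ℓ-not-negative third)
  ... | y , b , ℓ≡ = Substitute.shrinks y b ℓ≡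

-- The case |Q φ i| ≥ 3: eliminate xᵢ by fixing it to false.  The index d is an
-- arbitrary image for xᵢ itself, which never occurs after the deletion.
module Eliminate {n m : ℕ} (φ : CNF (suc n) m) (i : Fin (suc n)) (d : Fin n)
  (encodes : ForcedPEncoding φ) where

  sat : ∀ j → Satisfiable (assume (pos (x j)) φ)
  sat = proj₁ encodes

  ¬x-forced : ∀ j k → j ≢ k → Forced (assume (pos (x j)) φ) (neg (x k))
  ¬x-forced = proj₂ encodes

  lift : Var n m → Var (suc n) m
  lift (inj₁ j) = inj₁ (punchIn i j)
  lift (inj₂ y) = inj₂ y

  drop : Var (suc n) m → Var n m
  drop (inj₂ y) = inj₂ y
  drop (inj₁ v) with i FinP.≟ v
  ... | yes _ = inj₁ d
  ... | no i≢v = inj₁ (punchOut i≢v)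

  lift-drop : ∀ v → v ≢ x i → lift (drop v) ≡ v
  lift-drop (inj₂ y) _ = refl
  lift-drop (inj₁ v) v≢xᵢ with i FinP.≟ v
  ... | yes refl = ⊥-elim (v≢xᵢ refl)
  ... | no i≢v = cong inj₁ (FinP.punchIn-punchOut i≢v)

  drop-lift : ∀ w → drop (lift w) ≡ w
  drop-lift (inj₂ y) = refl
  drop-lift (inj₁ j) with i FinP.≟ punchIn i j
  ... | yes i≡ = ⊥-elim (FinP.punchInᵢ≢i i j (sym i≡))
  ... | no i≢ = cong inj₁ (trans (FinP.punchOut-cong i refl) (FinP.punchOut-punchIn i))

  dropL : Lit (suc n) m → Lit n m
  dropL (pos v) = pos (drop v)
  dropL (neg v) = neg (drop v)

  dropL-compl : (l : Lit (suc n) m) → dropL (compl l) ≡ compl (dropL l)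
  dropL-compl (pos v) = refl
  dropL-compl (neg v) = refl

  varOf-compl : (l : Lit (suc n) m) → varOf (compl l) ≡ varOf l
  varOf-compl (pos v) = refl
  varOf-compl (neg v) = refl

  eval-dropL : (a : Var (suc n) m → Bool) (l : Lit (suc n) m) → varOf l ≢ x i →
    evalLit (a ∘ lift) (dropL l) ≡ evalLit a l
  eval-dropL a (pos v) v≢xᵢ = cong a (lift-drop v v≢xᵢ)
  eval-dropL a (neg v) v≢xᵢ = cong (not ∘ a) (lift-drop v v≢xᵢ)

  not-xᵢ? : (l : Lit (suc n) m) → Dec (l ≢ pos (x i))
  not-xᵢ? l = ¬? (l ≟L pos (x i))

  restrict : Clause (suc n) m → Clause n m
  restrict C = map dropL (filter not-xᵢ? C)

  χ : CNF n m
  χ = map restrict (Qᶜ φ i)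

  off-xᵢ : ∀ {C : Clause (suc n) m} {l : Lit (suc n) m} →
    ¬ (neg (x i) ∈ C) → l ∈ C → l ≢ pos (x i) → varOf l ≢ x i
  off-xᵢ {l = pos _} _ _ l≢xᵢ refl = l≢xᵢ refl
  off-xᵢ {l = neg _} ¬xᵢ∉C l∈C _ refl = ¬xᵢ∉C l∈C

  -- Whenever u forces ¬xᵢ, forcing from u transfers to the restriction: no
  -- clause of Q can force anything else, as it would refute ¬xᵢ.
  translate : (u : Lit (suc n) m) → Satisfiable (assume u φ) → Forced (assume u φ) (neg (x i)) →
    ∀ {h} → varOf h ≢ x i → Forced (assume u φ) h → Forced (assume (dropL u) χ) (dropL h)
  translate u sat-u ¬xᵢ-forced _ (by _ (here refl) (here refl) _) = assumed-forced (dropL u)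
  translate u sat-u ¬xᵢ-forced {h} h-off-xᵢ (by E (there E∈φ) h∈E refuted) with ¬x∈? i E
  ... | yes ¬xᵢ∈E = ⊥-elim (forced-consistent sat-u
          (refuted (neg (x i)) ¬xᵢ∈E (λ ¬xᵢ≡h → h-off-xᵢ (cong varOf (sym ¬xᵢ≡h)))) ¬xᵢ-forced)
  ... | no ¬xᵢ∉E =
    by (restrict E) (there (rewrite-Qᶜ-∈ restrict E∈φ ¬xᵢ∉E))
      (∈P.∈-map⁺ dropL (∈P.∈-filter⁺ not-xᵢ? h∈E (λ h≡xᵢ → h-off-xᵢ (cong varOf h≡xᵢ)))) refuted′
    where
    refuted′ : ∀ l → l ∈ restrict E → l ≢ dropL h → Forced (assume (dropL u) χ) (compl l)
    refuted′ l l∈ l≢h with ∈P.∈-map⁻ dropL l∈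
    ... | l₀ , l₀∈ , refl with ∈P.∈-filter⁻ not-xᵢ? l₀∈
    ... | l₀∈E , l₀≢xᵢ = subst (Forced _) (dropL-compl l₀)
          (translate u sat-u ¬xᵢ-forced
            (λ e → off-xᵢ ¬xᵢ∉E l₀∈E l₀≢xᵢ (trans (sym (varOf-compl l₀)) e))
            (refuted l₀ l₀∈E (λ l₀≡h → l≢h (cong dropL l₀≡h))))

  restrict-model : (a : Var (suc n) m → Bool) → a (x i) ≡ false → Models a φ → Models (a ∘ lift) χ
  restrict-model a xᵢ-false M = rewrite-Qᶜ-tabulate restrict satisfied
    where
    satisfied : ∀ {C} → C ∈ φ → ¬ (neg (x i) ∈ C) →
      Any (λ l → evalLit (a ∘ lift) l ≡ true) (restrict C)
    satisfied C∈φ ¬xᵢ∉C with find (All.lookup M C∈φ)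
    ... | l , l∈C , l-true =
      lose (∈P.∈-map⁺ dropL (∈P.∈-filter⁺ not-xᵢ? l∈C l≢xᵢ))
        (trans (eval-dropL a l (off-xᵢ ¬xᵢ∉C l∈C l≢xᵢ)) l-true)
      where
      l≢xᵢ : l ≢ pos (x i)
      l≢xᵢ refl with trans (sym l-true) xᵢ-false
      ... | ()

  ¬xᵢ-forced : ∀ j → Forced (assume (pos (x (punchIn i j))) φ) (neg (x i))
  ¬xᵢ-forced j = ¬x-forced (punchIn i j) i (FinP.punchInᵢ≢i i j)

  χ-sat : ∀ j → Satisfiable (assume (pos (x j)) χ)
  χ-sat j with sat (punchIn i j)
  ... | a , M@(here xⱼ-true ∷ φ-true) = a ∘ lift , (here xⱼ-true ∷ restrict-model a xᵢ-false φ-true)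
    where
    xᵢ-false : a (x i) ≡ false
    xᵢ-false = trans (sym (not-involutive (a (x i)))) (cong not (forced-sound M (¬xᵢ-forced j)))

  χ-forces : ∀ j k → j ≢ k → Forced (assume (pos (x j)) χ) (neg (x k))
  χ-forces j k j≢k =
    subst₂ (λ u h → Forced (assume u χ) h) (cong pos (drop-lift (inj₁ j))) (cong neg (drop-lift (inj₁ k)))
      (translate (pos (x (punchIn i j))) (sat (punchIn i j)) (¬xᵢ-forced j) xₖ-off-xᵢ
        (¬x-forced (punchIn i j) (punchIn i k) (j≢k ∘ FinP.punchIn-injective i j k)))
    where
    xₖ-off-xᵢ : varOf (neg (x {m = m} (punchIn i k))) ≢ x i
    xₖ-off-xᵢ e = FinP.punchInᵢ≢i i k (SumP.inj₁-injective e)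

  shrinks : 3 ≤ size (Q φ i) → Shrinks n 3 φ
  shrinks |Q|≥3 = shrinks-by-normalising χ (χ-sat , χ-forces) smaller (rewrite-Qᶜ-2CNF restrict shorter)
    where
    smaller : size χ + 3 ≤ size φ
    smaller = ℕP.≤-trans (ℕP.+-monoʳ-≤ (size χ) |Q|≥3) (ℕP.≤-reflexive (rewrite-Qᶜ-size restrict φ i))
    shorter : ∀ C → length (restrict C) ≤ length C
    shorter C = ℕP.≤-trans (ℕP.≤-reflexive (ListP.length-map dropL (filter not-xᵢ? C)))
                  (ListP.length-filter not-xᵢ? C)

another : (i : Fin (suc (suc n))) → ∃ λ j → j ≢ i
another fz = fs fz , λ ()
another (fs i) = fz , λ ()

a-third : (i k : Fin (suc (suc (suc n)))) → ∃ λ t → t ≢ i × t ≢ k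
a-third i k with fz FinP.≟ i | fz FinP.≟ k
... | no 0≢i | no 0≢k = fz , 0≢i , 0≢k
... | yes refl | _ with fs fz FinP.≟ k
...   | no 1≢k = fs fz , (λ ()) , 1≢k
...   | yes refl = fs (fs fz) , (λ ()) , (λ ())
a-third i k | no _ | yes refl with fs fz FinP.≟ i
...   | no 1≢i = fs fz , 1≢i , (λ ())
...   | yes refl = fs (fs fz) , (λ ()) , (λ ())

proposition3 : (n m : ℕ) → (φ : CNF n m) → 3 ≤ n → WF φ → IsPEncoding φ →
    (∃ λ (i : Fin n) → size (Q φ i) ≢ 2) →
    (Σ ℕ λ m' → Σ (CNF n m') λ φ' →
        WF φ' × IsPEncoding φ' × size φ' + 1 ≤ size φ × (Is2CNF φ → Is2CNF φ'))
    ⊎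
    (Σ ℕ λ m' → Σ (CNF (n ∸ 1) m') λ φ' →
        WF φ' × IsPEncoding φ' × size φ' + 3 ≤ size φ × (Is2CNF φ → Is2CNF φ'))
proposition3 (suc (suc (suc k))) m φ _ wf is-encoding (i , |Q|≢2) = by-size-of-Q (size (Q φ i)) refl
  where
  encodes : ForcedPEncoding φ
  encodes = PEncoding→Forced is-encoding
  pivotᵢ : Pivot φ i
  pivotᵢ with another i
  ... | j , j≢i = pivot-exists encodes i j j≢i
  by-size-of-Q : ∀ q → size (Q φ i) ≡ q → Shrinks (3 + k) 1 φ ⊎ Shrinks (2 + k) 3 φ
  by-size-of-Q 0 |Q|≡0 = ⊥-elim (pivot-in-Q pivotᵢ |Q|≡0)
  by-size-of-Q 1 |Q|≡1 = inj₁ (UniquePivot.shrinks φ i pivotᵢ encodes |Q|≡1 wf (a-third i))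
  by-size-of-Q 2 |Q|≡2 = ⊥-elim (|Q|≢2 |Q|≡2)
  by-size-of-Q (suc (suc (suc q))) |Q|≡ =
    inj₂ (Eliminate.shrinks φ i fz encodes (subst (3 ≤_) (sym |Q|≡) (ℕP.m≤m+n 3 q)))
proposition3 0 _ _ () _ _ _
proposition3 1 _ _ (s≤s ()) _ _ _
proposition3 2 _ _ (s≤s (s≤s ())) _ _ _
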